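{- For every $k \geq 2$, the DCell graph $D_{k,2}$ is not vertex-transitive.
   Context: DCell graphs $D_{k,n}$ ($k \geq 0$, $n \geq 2$) are defined recursively. $D_{0,n}$ is the complete graph $K_n$ on vertices labeled $0,1,\dots,n-1$. Let $t_{k,n}$ denote the number of vertices of $D_{k,n}$. For $k \geq 1$, $D_{k,n}$ consists of $t_{k-1,n}+1$ disjoint copies $D^i_{k-1,n}$, $i = 0,1,\dots,t_{k-1,n}$, of $D_{k-1,n}$; a vertex of $D^i_{k-1,n}$ is labeled $(i,a_{k-1},\dots,a_0)$, where $(a_{k-1},\dots,a_0)$ is its label in $D_{k-1,n}$. For a suffix $(a_j,\dots,a_0)$ define $uid_j = a_0 + \sum_{l=1}^{j} a_l\, t_{l-1,n}$. Besides the edges inside the copies, for every pair $a<b$ of copy indices there is exactly one additional edge, joining the vertex of $D^a_{k-1,n}$ whose suffix has $uid_{k-1} = b-1$ to the vertex of $D^b_{k-1,n}$ whose suffix has $uid_{k-1} = a$. A graph is vertex-transitive if its automorphism group acts transitively on its vertices. -}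

module Defs where

open import Level using (0ℓ)
open import Data.Nat using (ℕ; zero; suc; _+_; _*_; _∸_; _<_)
open import Data.Fin using (Fin; toℕ)
open import Data.Product using (Σ; _×_; _,_)
open import Data.Sum using (_⊎_)
open import Relation.Nullary using (¬_)
open import Relation.Binary.PropositionalEquality using (_≡_; _≢_)
open import Function.Bundles using (Bijection; _⤖_; _⇔_)

-- t k n = number of vertices of D_{k,n}
t : ℕ → ℕ → ℕ
t zero    n = n
t (suc k) n = t k n * suc (t k n)

-- Labels of vertices of D_{k,n}: D_{0,n} has labels 0..n-1;
-- D_{k+1,n} has labels (i , a) with i a copy index in 0..t_{k,n} and a a label of D_{k,n}.
Label : ℕ → ℕ → Set
Label zero    n = Fin n
Label (suc k) n = Fin (suc (t k n)) × Label k n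

uid : (k n : ℕ) → Label k n → ℕ
uid zero    n a       = toℕ a
uid (suc k) n (i , a) = toℕ i * t k n + uid k n a

Adj : (k n : ℕ) → Label k n → Label k n → Set
Adj zero    n x y = x ≢ y
Adj (suc k) n (i , u) (j , v) =
    (i ≡ j × Adj k n u v)
  ⊎ (toℕ i < toℕ j × uid k n u ≡ toℕ j ∸ 1 × uid k n v ≡ toℕ i)
  ⊎ (toℕ j < toℕ i × uid k n v ≡ toℕ i ∸ 1 × uid k n u ≡ toℕ j)

record Graph : Set₁ where
  field
    V   : Set
    _~_ : V → V → Set

DCell : ℕ → ℕ → Graph
DCell k n = record { V = Label k n ; _~_ = Adj k n }

IsAutomorphism : (G : Graph) → (Graph.V G ⤖ Graph.V G) → Set
IsAutomorphism G f = ∀ x y → (x ~ y) ⇔ (Bijection.to f x ~ Bijection.to f y)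
  where open Graph G

VertexTransitive : Graph → Set
VertexTransitive G = ∀ (x y : Graph.V G) →
  Σ (Graph.V G ⤖ Graph.V G) λ f → IsAutomorphism G f × Bijection.to f x ≡ y

-- An automorphism maps a 6-cycle through an edge to a 6-cycle through the image edge. In
-- D_{k,2} with k ≥ 2 every edge at the vertex 0…0 lies on a 6-cycle, but the bridge between
-- copies 0 and 4 of D_{k-1,2} does not. Since each vertex lies on exactly one bridge and two
-- copies are joined by exactly one bridge, such a cycle would have to leave copy 4 by a bridge
-- into a third copy c, cross one edge of c and leave c by a bridge into copy 0. The latter
-- forces the uid 0 at its end, the former the uid 3 or 4 at its start, and no neighbour of the
-- vertex with uid 0 has uid 3 or 4.
module Submission where

open import Data.Fin as Fin using (Fin; toℕ; fromℕ<; cast; combine)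
open import Data.Fin.Properties using (toℕ-injective; toℕ-fromℕ<; toℕ<n; toℕ-cast; toℕ-combine; combine-injective)
open import Data.Nat using (ℕ; zero; suc; _+_; _*_; _∸_; _≤_; _<_; z≤n; s≤s; z<s; s<s)
open import Data.Nat.Properties
open import Data.Product using (_×_; _,_; proj₂; ∃-syntax)
open import Data.Sum using (_⊎_; inj₁; inj₂; swap)
open import Function using (_∘_)
open import Function.Bundles using (Bijection; Equivalence; Surjection)
open import Relation.Binary.PropositionalEquality
open import Relation.Nullary using (¬_; contradiction)

open import Defs

-- The uid is the mixed-radix numeral of a label, so it enumerates the labels bijectively.
index : ∀ k {n} → Label k n → Fin (t k n)
index zero          a       = a
index (suc k) {n}   (i , a) = cast (*-comm (suc (t k n)) (t k n)) (combine i (index k a))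

toℕ-index : ∀ k {n} (a : Label k n) → toℕ (index k a) ≡ uid k n a
toℕ-index zero        a       = refl
toℕ-index (suc k) {n} (i , a) = begin
  toℕ (cast _ (combine i (index k a)))  ≡⟨ toℕ-cast _ (combine i (index k a)) ⟩
  toℕ (combine i (index k a))           ≡⟨ toℕ-combine i (index k a) ⟩
  t k n * toℕ i + toℕ (index k a)       ≡⟨ cong₂ _+_ (*-comm (t k n) (toℕ i)) (toℕ-index k a) ⟩
  toℕ i * t k n + uid k n a             ∎
  where open ≡-Reasoning

cast-injective : ∀ {m n} .(eq : m ≡ n) {i j : Fin m} → cast eq i ≡ cast eq j → i ≡ j
cast-injective eq {i} {j} e =
  toℕ-injective (trans (sym (toℕ-cast eq i)) (trans (cong toℕ e) (toℕ-cast eq j)))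

index-injective : ∀ k {n} {a b : Label k n} → index k a ≡ index k b → a ≡ b
index-injective zero    e = e
index-injective (suc k) {a = i , a} {j , b} e
  with refl , same ← combine-injective i (index k a) j (index k b) (cast-injective _ e)
  = cong (i ,_) (index-injective k same)

uid-injective : ∀ k {n} {a b : Label k n} → uid k n a ≡ uid k n b → a ≡ b
uid-injective k {a = a} {b} eq =
  index-injective k (toℕ-injective (trans (toℕ-index k a) (trans eq (sym (toℕ-index k b)))))

-- Adj (suc k) n x y unfolds to (same copy × Adj k n) ⊎ Bridge k n x y.
Link : ∀ k n → Fin (suc (t k n)) → Label k n → Fin (suc (t k n)) → Label k n → Set
Link k n i u j v = toℕ i < toℕ j × uid k n u ≡ toℕ j ∸ 1 × uid k n v ≡ toℕ i

Bridge : ∀ k n → Label (suc k) n → Label (suc k) n → Set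
Bridge k n (i , u) (j , v) = Link k n i u j v ⊎ Link k n j v i u

link : ∀ {k n i j p q} {u v : Label k n} → toℕ i ≡ p → toℕ j ≡ q →
       p < q → uid k n u ≡ q ∸ 1 → uid k n v ≡ p → Link k n i u j v
link refl refl p<q u≡q-1 v≡p = p<q , u≡q-1 , v≡p

bridge-sym : ∀ k {n} {x y : Label (suc k) n} → Bridge k n x y → Bridge k n y x
bridge-sym _ = swap

adj-sym : ∀ k {n} {x y : Label k n} → Adj k n x y → Adj k n y x
adj-sym zero    x≢y                 = x≢y ∘ sym
adj-sym (suc k) (inj₁ (refl , u~v)) = inj₁ (refl , adj-sym k u~v)
adj-sym (suc k) (inj₂ bridge)       = inj₂ (bridge-sym k bridge)

bridge-endpoint-uid : ∀ k {n i j} {u v : Label k n} → Bridge k n (i , u) (j , v) →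
                      uid k n v ≡ toℕ i ⊎ uid k n v ≡ toℕ i ∸ 1
bridge-endpoint-uid _ (inj₁ (_ , _ , v≡i))   = inj₁ v≡i
bridge-endpoint-uid _ (inj₂ (_ , v≡i-1 , _)) = inj₂ v≡i-1

bridge-functional : ∀ k {n i j j′} {u v v′ : Label k n} →
                    Bridge k n (i , u) (j , v) → Bridge k n (i , u) (j′ , v′) → (j , v) ≡ (j′ , v′)
bridge-functional k (inj₁ (i<j , u≡j-1 , v≡i)) (inj₁ (i<j′ , u≡j′-1 , v′≡i)) =
  cong₂ _,_ (toℕ-injective (∸-cancelʳ-≡ (m<n⇒0<n i<j) (m<n⇒0<n i<j′) (trans (sym u≡j-1) u≡j′-1)))
            (uid-injective k (trans v≡i (sym v′≡i)))
bridge-functional _ (inj₁ (i<j , u≡j-1 , _)) (inj₂ (j′<i , _ , u≡j′)) =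
  contradiction (subst (_< _) (trans (sym u≡j′) u≡j-1) j′<i) (≤⇒≯ (<⇒≤pred i<j))
bridge-functional _ (inj₂ (j<i , _ , u≡j)) (inj₁ (i<j′ , u≡j′-1 , _)) =
  contradiction (subst (_< _) (trans (sym u≡j) u≡j′-1) j<i) (≤⇒≯ (<⇒≤pred i<j′))
bridge-functional k (inj₂ (_ , v≡i-1 , u≡j)) (inj₂ (_ , v′≡i-1 , u≡j′)) =
  cong₂ _,_ (toℕ-injective (trans (sym u≡j) u≡j′)) (uid-injective k (trans v≡i-1 (sym v′≡i-1)))

bridge-between-copies : ∀ k {n i j} {u u′ v v′ : Label k n} →
                        Bridge k n (i , u) (j , v) → Bridge k n (i , u′) (j , v′) → u ≡ u′ × v ≡ v′
bridge-between-copies k (inj₁ (_ , u≡ , v≡)) (inj₁ (_ , u′≡ , v′≡)) =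
  uid-injective k (trans u≡ (sym u′≡)) , uid-injective k (trans v≡ (sym v′≡))
bridge-between-copies _ (inj₁ (i<j , _)) (inj₂ (j<i , _)) = contradiction i<j (<-asym j<i)
bridge-between-copies _ (inj₂ (j<i , _)) (inj₁ (i<j , _)) = contradiction i<j (<-asym j<i)
bridge-between-copies k (inj₂ (_ , v≡ , u≡)) (inj₂ (_ , v′≡ , u′≡)) =
  uid-injective k (trans u≡ (sym u′≡)) , uid-injective k (trans v≡ (sym v′≡))

2≤t : ∀ l {n} → 2 ≤ t l (suc (suc n))
2≤t zero    = s≤s (s≤s z≤n)
2≤t (suc l) = ≤-trans (s≤s (s≤s z≤n)) (*-mono-≤ (2≤t l) (s≤s (2≤t l)))

6≤t : ∀ l {n} → 6 ≤ t (suc l) (suc (suc n))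
6≤t l = *-mono-≤ (2≤t l) (s≤s (2≤t l))

vertex₀ : ∀ k {n} → Label k (suc n)
vertex₀ zero    = Fin.zero
vertex₀ (suc k) = Fin.zero , vertex₀ k

vertex₁ : ∀ k {n} → Label k (suc (suc n))
vertex₁ zero    = Fin.suc Fin.zero
vertex₁ (suc k) = Fin.zero , vertex₁ k

uid-vertex₀ : ∀ k {n} → uid k (suc n) (vertex₀ k) ≡ 0
uid-vertex₀ zero    = refl
uid-vertex₀ (suc k) = uid-vertex₀ k

uid-vertex₁ : ∀ k {n} → uid k (suc (suc n)) (vertex₁ k) ≡ 1
uid-vertex₁ zero    = refl
uid-vertex₁ (suc k) = uid-vertex₁ k

vertex₀~vertex₁ : ∀ k {n} → Adj k (suc (suc n)) (vertex₀ k) (vertex₁ k)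
vertex₀~vertex₁ zero    ()
vertex₀~vertex₁ (suc k) = inj₁ (refl , vertex₀~vertex₁ k)

bridge-from-copy₀ : ∀ k {n c} {u w : Label k (suc n)} →
                    Bridge k (suc n) (Fin.zero , u) (c , w) → w ≡ vertex₀ k
bridge-from-copy₀ k (inj₁ (_ , _ , w≡0)) = uid-injective k (trans w≡0 (sym (uid-vertex₀ k)))
bridge-from-copy₀ k (inj₂ (() , _))

-- The neighbours of vertex₀ are the other vertices of its K_n and, for each level l, the
-- first vertex of copy 1 of D_{l+1,n}.
uid-neighbour-of-vertex₀ : ∀ k {n} {w : Label k (suc n)} → Adj k (suc n) (vertex₀ k) w →
                           uid k (suc n) w < suc n ⊎ ∃[ l ] uid k (suc n) w ≡ t l (suc n)
uid-neighbour-of-vertex₀ zero    {w = w} _                     = inj₁ (toℕ<n w)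
uid-neighbour-of-vertex₀ (suc k)         (inj₁ (refl , inner)) = uid-neighbour-of-vertex₀ k inner
uid-neighbour-of-vertex₀ (suc k) {n} {j , w} (inj₂ (inj₁ (0<j , v₀≡j-1 , w≡0))) = inj₂ (k , (begin
  toℕ j * T + uid k (suc n) w  ≡⟨ cong₂ (λ c d → c * T + d) j≡1 w≡0 ⟩
  1 * T + 0                    ≡⟨ trans (+-identityʳ _) (*-identityˡ T) ⟩
  T                            ∎))
  where
  open ≡-Reasoning
  T : ℕ
  T = t k (suc n)
  j≡1 : toℕ j ≡ 1
  j≡1 = ≤-antisym (m∸n≡0⇒m≤n (trans (sym v₀≡j-1) (uid-vertex₀ k))) 0<j
uid-neighbour-of-vertex₀ (suc k) (inj₂ (inj₂ (() , _)))

uid-neighbour-of-vertex₀≢3,4 : ∀ k {w : Label k 2} → Adj k 2 (vertex₀ k) w →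
                               uid k 2 w ≢ 3 × uid k 2 w ≢ 4
uid-neighbour-of-vertex₀≢3,4 k v₀~w = not-3-or-4 (uid-neighbour-of-vertex₀ k v₀~w)
  where
  not-3-or-4 : ∀ {x} → x < 2 ⊎ ∃[ l ] x ≡ t l 2 → x ≢ 3 × x ≢ 4
  not-3-or-4 (inj₁ x<2)            = <⇒≢ (m<n⇒m<1+n x<2) , <⇒≢ (m<n⇒m<1+n (m<n⇒m<1+n x<2))
  not-3-or-4 (inj₂ (zero , refl))  = (λ ()) , (λ ())
  not-3-or-4 (inj₂ (suc l , refl)) = >⇒≢ (≤-trans (s≤s (s≤s (s≤s (s≤s z≤n)))) (6≤t l))
                                   , >⇒≢ (≤-trans (s≤s (s≤s (s≤s (s≤s (s≤s z≤n))))) (6≤t l))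

record SixCycle {V : Set} (_~_ : V → V → Set) (v₀ v₁ : V) : Set where
  field
    v₂ v₃ v₄ v₅ : V
    e₀₁ : v₀ ~ v₁
    e₁₂ : v₁ ~ v₂
    e₂₃ : v₂ ~ v₃
    e₃₄ : v₃ ~ v₄
    e₄₅ : v₄ ~ v₅
    e₅₀ : v₅ ~ v₀
    d₀₁ : v₀ ≢ v₁
    d₀₂ : v₀ ≢ v₂
    d₀₃ : v₀ ≢ v₃
    d₀₄ : v₀ ≢ v₄
    d₀₅ : v₀ ≢ v₅
    d₁₂ : v₁ ≢ v₂
    d₁₃ : v₁ ≢ v₃
    d₁₄ : v₁ ≢ v₄
    d₁₅ : v₁ ≢ v₅
    d₂₃ : v₂ ≢ v₃
    d₂₄ : v₂ ≢ v₄
    d₂₅ : v₂ ≢ v₅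
    d₃₄ : v₃ ≢ v₄
    d₃₅ : v₃ ≢ v₅
    d₄₅ : v₄ ≢ v₅

SixCycle-reverse : ∀ {V : Set} {_~_ : V → V → Set} → (∀ {x y} → x ~ y → y ~ x) →
                   ∀ {v₀ v₁} (c : SixCycle _~_ v₀ v₁) → SixCycle _~_ v₀ (SixCycle.v₅ c)
SixCycle-reverse sym~ c = record
  { v₂ = v₄ ; v₃ = v₃ ; v₄ = v₂ ; v₅ = _
  ; e₀₁ = sym~ e₅₀ ; e₁₂ = sym~ e₄₅ ; e₂₃ = sym~ e₃₄ ; e₃₄ = sym~ e₂₃ ; e₄₅ = sym~ e₁₂ ; e₅₀ = sym~ e₀₁
  ; d₀₁ = d₀₅ ; d₀₂ = d₀₄ ; d₀₃ = d₀₃ ; d₀₄ = d₀₂ ; d₀₅ = d₀₁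
  ; d₁₂ = d₄₅ ∘ sym ; d₁₃ = d₃₅ ∘ sym ; d₁₄ = d₂₅ ∘ sym ; d₁₅ = d₁₅ ∘ sym
  ; d₂₃ = d₃₄ ∘ sym ; d₂₄ = d₂₄ ∘ sym ; d₂₅ = d₁₄ ∘ sym
  ; d₃₄ = d₂₃ ∘ sym ; d₃₅ = d₁₃ ∘ sym ; d₄₅ = d₁₂ ∘ sym }
  where open SixCycle c

SixCycle-map : ∀ {V W : Set} {_~_ : V → V → Set} {_≈_ : W → W → Set} (f : V → W) →
               (∀ {x y} → f x ≡ f y → x ≡ y) → (∀ {x y} → x ~ y → f x ≈ f y) →
               ∀ {v₀ v₁} → SixCycle _~_ v₀ v₁ → SixCycle _≈_ (f v₀) (f v₁)
SixCycle-map f inj hom c = record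
  { v₂ = f v₂ ; v₃ = f v₃ ; v₄ = f v₄ ; v₅ = f v₅
  ; e₀₁ = hom e₀₁ ; e₁₂ = hom e₁₂ ; e₂₃ = hom e₂₃ ; e₃₄ = hom e₃₄ ; e₄₅ = hom e₄₅ ; e₅₀ = hom e₅₀
  ; d₀₁ = d₀₁ ∘ inj ; d₀₂ = d₀₂ ∘ inj ; d₀₃ = d₀₃ ∘ inj ; d₀₄ = d₀₄ ∘ inj ; d₀₅ = d₀₅ ∘ inj
  ; d₁₂ = d₁₂ ∘ inj ; d₁₃ = d₁₃ ∘ inj ; d₁₄ = d₁₄ ∘ inj ; d₁₅ = d₁₅ ∘ inj
  ; d₂₃ = d₂₃ ∘ inj ; d₂₄ = d₂₄ ∘ inj ; d₂₅ = d₂₅ ∘ inj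
  ; d₃₄ = d₃₄ ∘ inj ; d₃₅ = d₃₅ ∘ inj ; d₄₅ = d₄₅ ∘ inj }
  where open SixCycle c

six-cycles⇒¬VertexTransitive : (G : Graph) {x y z : Graph.V G} → let open Graph G in
                               (∀ {w} → x ~ w → SixCycle _~_ x w) → y ~ z → ¬ SixCycle _~_ y z →
                               ¬ VertexTransitive G
six-cycles⇒¬VertexTransitive G {x} {y} {z} cycles-at-x y~z no-cycle vt with vt x y
... | f , aut , refl = no-cycle (subst (SixCycle _~_ (to x)) (to∘to⁻ z)
  (SixCycle-map to injective (Equivalence.to (aut _ _)) (cycles-at-x x~w)))
  where
  open Graph G
  open Bijection f using (to; injective; surjection)
  open Surjection surjection using (to⁻; to∘to⁻)
  x~w : x ~ to⁻ z
  x~w = Equivalence.from (aut x (to⁻ z)) (subst (to x ~_) (sym (to∘to⁻ z)) y~z)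

position : ∀ {k n} → Label (suc k) n → ℕ × ℕ
position {k} {n} (i , a) = toℕ i , uid k n a

distinct-positions : ∀ {k n} {x y : Label (suc k) n} {p q : ℕ × ℕ} →
                     position x ≡ p → position y ≡ q → p ≢ q → x ≢ y
distinct-positions x↦p y↦q p≢q refl = p≢q (trans (sym x↦p) y↦q)

module _ (m : ℕ) {n : ℕ} where

  private
    T : ℕ
    T = t m (suc (suc n))

  copy₁ copy₂ : Fin (suc T)
  copy₁ = fromℕ< (s≤s (≤-trans (s≤s z≤n) (2≤t m)))
  copy₂ = fromℕ< (s≤s (2≤t m))

  toℕ-copy₁ : toℕ copy₁ ≡ 1
  toℕ-copy₁ = toℕ-fromℕ< (s≤s (≤-trans (s≤s z≤n) (2≤t m)))

  toℕ-copy₂ : toℕ copy₂ ≡ 2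
  toℕ-copy₂ = toℕ-fromℕ< (s≤s (2≤t m))

  bridge-at-vertex₀ : Bridge m (suc (suc n)) (vertex₀ (suc m)) (copy₁ , vertex₀ m)
  bridge-at-vertex₀ = inj₁ (link {m} refl toℕ-copy₁ z<s (uid-vertex₀ m) (uid-vertex₀ m))

  -- The bridges between copies 0, 1 and 2 close up, through the edges vertex₀–vertex₁ inside
  -- these copies, to a hexagon.
  hexagon : SixCycle (Adj (suc m) (suc (suc n))) (vertex₀ (suc m)) (copy₁ , vertex₀ m)
  hexagon = record
    { v₂ = copy₁ , vertex₁ m ; v₃ = copy₂ , vertex₁ m ; v₄ = copy₂ , vertex₀ m ; v₅ = Fin.zero , vertex₁ m
    ; e₀₁ = inj₂ bridge-at-vertex₀
    ; e₁₂ = inj₁ (refl , vertex₀~vertex₁ m)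
    ; e₂₃ = inj₂ (inj₁ (link {m} toℕ-copy₁ toℕ-copy₂ (s<s z<s) (uid-vertex₁ m) (uid-vertex₁ m)))
    ; e₃₄ = inj₁ (refl , adj-sym m (vertex₀~vertex₁ m))
    ; e₄₅ = inj₂ (inj₂ (link {m} refl toℕ-copy₂ z<s (uid-vertex₁ m) (uid-vertex₀ m)))
    ; e₅₀ = inj₁ (refl , adj-sym m (vertex₀~vertex₁ m))
    ; d₀₁ = distinct-positions p₀ p₁ λ ()
    ; d₀₂ = distinct-positions p₀ p₂ λ ()
    ; d₀₃ = distinct-positions p₀ p₃ λ ()
    ; d₀₄ = distinct-positions p₀ p₄ λ ()
    ; d₀₅ = distinct-positions p₀ p₅ λ ()
    ; d₁₂ = distinct-positions p₁ p₂ λ ()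
    ; d₁₃ = distinct-positions p₁ p₃ λ ()
    ; d₁₄ = distinct-positions p₁ p₄ λ ()
    ; d₁₅ = distinct-positions p₁ p₅ λ ()
    ; d₂₃ = distinct-positions p₂ p₃ λ ()
    ; d₂₄ = distinct-positions p₂ p₄ λ ()
    ; d₂₅ = distinct-positions p₂ p₅ λ ()
    ; d₃₄ = distinct-positions p₃ p₄ λ ()
    ; d₃₅ = distinct-positions p₃ p₅ λ ()
    ; d₄₅ = distinct-positions p₄ p₅ λ ()
    }
    where
    p₀ : position {m} (vertex₀ (suc m)) ≡ (0 , 0)
    p₀ = cong (0 ,_) (uid-vertex₀ m)
    p₁ : position {m} (copy₁ , vertex₀ m) ≡ (1 , 0)
    p₁ = cong₂ _,_ toℕ-copy₁ (uid-vertex₀ m)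
    p₂ : position {m} (copy₁ , vertex₁ m) ≡ (1 , 1)
    p₂ = cong₂ _,_ toℕ-copy₁ (uid-vertex₁ m)
    p₃ : position {m} (copy₂ , vertex₁ m) ≡ (2 , 1)
    p₃ = cong₂ _,_ toℕ-copy₂ (uid-vertex₁ m)
    p₄ : position {m} (copy₂ , vertex₀ m) ≡ (2 , 0)
    p₄ = cong₂ _,_ toℕ-copy₂ (uid-vertex₀ m)
    p₅ : position {m} (Fin.zero , vertex₁ m) ≡ (0 , 1)
    p₅ = cong (0 ,_) (uid-vertex₁ m)

edges-at-vertex₀-on-six-cycles : ∀ m {w} → Adj (suc m) 2 (vertex₀ (suc m)) w →
                                 SixCycle (Adj (suc m) 2) (vertex₀ (suc m)) w
edges-at-vertex₀-on-six-cycles zero {_ , Fin.zero}         (inj₁ (refl , 0≢0)) = contradiction refl 0≢0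
edges-at-vertex₀-on-six-cycles zero {_ , Fin.suc Fin.zero} (inj₁ (refl , _))   =
  SixCycle-reverse (adj-sym 1) (hexagon 0)
edges-at-vertex₀-on-six-cycles (suc m) (inj₁ (refl , inner)) =
  SixCycle-map (Fin.zero ,_) (cong proj₂) (λ e → inj₁ (refl , e)) (edges-at-vertex₀-on-six-cycles m inner)
edges-at-vertex₀-on-six-cycles m       (inj₂ bridge) =
  subst (SixCycle _ _) (bridge-functional m (bridge-at-vertex₀ m) bridge) (hexagon m)

bridge-0-4-not-on-six-cycle : ∀ k {c : Fin (suc (t k 2))} {u w : Label k 2} → toℕ c ≡ 4 →
                              Bridge k 2 (Fin.zero , u) (c , w) →
                              ¬ SixCycle (Adj (suc k) 2) (Fin.zero , u) (c , w)
bridge-0-4-not-on-six-cycle k _ yz record { e₁₂ = inj₂ b₁₂ ; d₀₂ = d₀₂ } =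
  d₀₂ (bridge-functional k (bridge-sym k yz) b₁₂)
bridge-0-4-not-on-six-cycle k _ yz record { e₅₀ = inj₂ b₅₀ ; d₁₅ = d₁₅ } =
  d₁₅ (bridge-functional k yz (bridge-sym k b₅₀))
bridge-0-4-not-on-six-cycle k _ _ record { e₂₃ = inj₂ b₂₃ ; e₃₄ = inj₂ b₃₄ ; d₂₄ = d₂₄ } =
  d₂₄ (bridge-functional k (bridge-sym k b₂₃) b₃₄)
bridge-0-4-not-on-six-cycle k _ _ record { e₃₄ = inj₂ b₃₄ ; e₄₅ = inj₂ b₄₅ ; d₃₅ = d₃₅ } =
  d₃₅ (bridge-functional k (bridge-sym k b₃₄) b₄₅)
bridge-0-4-not-on-six-cycle k c≡4 _ record { e₁₂ = inj₁ (refl , _) ; e₂₃ = inj₁ (refl , _) ; e₃₄ = inj₁ (refl , _)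
                                           ; e₄₅ = inj₁ (c≡0 , _) ; e₅₀ = inj₁ (refl , _) } =
  contradiction (trans (sym (cong toℕ c≡0)) c≡4) λ ()
bridge-0-4-not-on-six-cycle k _ yz record { e₁₂ = inj₁ (refl , _) ; e₂₃ = inj₁ (refl , _) ; e₃₄ = inj₁ (refl , _)
                                          ; e₄₅ = inj₂ b₄₅ ; e₅₀ = inj₁ (refl , _) ; d₁₄ = d₁₄ } =
  d₁₄ (cong (_ ,_) (proj₂ (bridge-between-copies k yz (bridge-sym k b₄₅))))
bridge-0-4-not-on-six-cycle k _ yz record { e₁₂ = inj₁ (refl , _) ; e₂₃ = inj₁ (refl , _) ; e₃₄ = inj₂ b₃₄
                                          ; e₄₅ = inj₁ (refl , _) ; e₅₀ = inj₁ (refl , _) ; d₁₃ = d₁₃ } =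
  d₁₃ (cong (_ ,_) (proj₂ (bridge-between-copies k yz (bridge-sym k b₃₄))))
bridge-0-4-not-on-six-cycle k _ yz record { e₁₂ = inj₁ (refl , _) ; e₂₃ = inj₂ b₂₃ ; e₃₄ = inj₁ (refl , _)
                                          ; e₄₅ = inj₁ (refl , _) ; e₅₀ = inj₁ (refl , _) ; d₁₂ = d₁₂ } =
  d₁₂ (cong (_ ,_) (proj₂ (bridge-between-copies k yz (bridge-sym k b₂₃))))
bridge-0-4-not-on-six-cycle k c≡4 _ record { e₁₂ = inj₁ (refl , _) ; e₂₃ = inj₂ b₂₃ ; e₃₄ = inj₁ (refl , w₃~w₄)
                                           ; e₄₅ = inj₂ b₄₅ ; e₅₀ = inj₁ (refl , _) }
  with uid-neighbour-of-vertex₀≢3,4 k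
         (subst (λ a → Adj k 2 a _) (bridge-from-copy₀ k (bridge-sym k b₄₅)) (adj-sym k w₃~w₄))
     | bridge-endpoint-uid k b₂₃
... | _ , w₃≢4 | inj₁ w₃≡c   = w₃≢4 (trans w₃≡c c≡4)
... | w₃≢3 , _ | inj₂ w₃≡c-1 = w₃≢3 (trans w₃≡c-1 (cong (_∸ 1) c≡4))

vertex₃ : ∀ k → Label (suc k) 2
vertex₃ zero    = Fin.suc Fin.zero , Fin.suc Fin.zero
vertex₃ (suc k) = Fin.zero , vertex₃ k

uid-vertex₃ : ∀ k → uid (suc k) 2 (vertex₃ k) ≡ 3
uid-vertex₃ zero    = refl
uid-vertex₃ (suc k) = uid-vertex₃ k

lemma5 : ∀ (k : ℕ) → 2 ≤ k → ¬ VertexTransitive (DCell k 2)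
lemma5 (suc zero) (s≤s ())
lemma5 (suc (suc m)) _ =
  six-cycles⇒¬VertexTransitive (DCell (2 + m) 2) {vertex₀ (2 + m)} {y} {z}
    (edges-at-vertex₀-on-six-cycles (suc m)) (inj₂ bridge-0-4)
    (bridge-0-4-not-on-six-cycle (suc m) toℕ-copy₄ bridge-0-4)
  where
  4≤t : 4 ≤ t (suc m) 2
  4≤t = ≤-trans (s≤s (s≤s (s≤s (s≤s z≤n)))) (6≤t m)
  copy₄ : Fin (suc (t (suc m) 2))
  copy₄ = fromℕ< (s≤s 4≤t)
  toℕ-copy₄ : toℕ copy₄ ≡ 4
  toℕ-copy₄ = toℕ-fromℕ< (s≤s 4≤t)
  y z : Label (2 + m) 2
  y = Fin.zero , vertex₃ m
  z = copy₄ , vertex₀ (suc m)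
  bridge-0-4 : Bridge (suc m) 2 y z
  bridge-0-4 = inj₁ (link {u = vertex₃ m} {vertex₀ (suc m)}
                          refl toℕ-copy₄ z<s (uid-vertex₃ m) (uid-vertex₀ (suc m)))
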